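{- For $n\ge 0$ and $\lambda,\beta,\mu\in C(n)$ define $$A_n(\lambda,\beta)=\chi(\lambda\le\beta)\,L_{\beta,\lambda},\qquad B_n(\beta,\mu)=(-1)^{\ell(\beta)-\ell(\mu)}\chi(\beta\le\mu)\,Z_{\mu,\beta}^{ -1}.$$ Then the $C(n)\times C(n)$ matrices $A_n$ and $B_n$ are inverses of each other.
   Context: $C(n)$ is the set of compositions of $n$; $\ell(\alpha)$ is the number of parts and $L(\alpha)$ the last part. For $\alpha,\beta\in C(n)$, $\beta\le\alpha$ ($\beta$ refines $\alpha$) means there exist indices $0=i_0<i_1<\dots<i_{\ell(\alpha)}=\ell(\beta)$ with $\alpha_k=\beta_{i_{k-1}+1}+\dots+\beta_{i_k}$ for all $k$; these indices are then unique, and we set $\beta^{(k)}=(\beta_{i_{k-1}+1},\dots,\beta_{i_k})\in C(\alpha_k)$. For a composition $\gamma=(\gamma_1,\dots,\gamma_s)$, $Z_\gamma=\gamma_1(\gamma_1+\gamma_2)\cdots(\gamma_1+\dots+\gamma_s)$. When $\beta\le\alpha$, define $Z_{\alpha,\beta}=\prod_{k=1}^{\ell(\alpha)}Z_{\beta^{(k)}}$ and $L_{\alpha,\beta}=\prod_{k=1}^{\ell(\alpha)}L(\beta^{(k)})$ (empty products equal 1). $\chi(Q)$ is 1 if $Q$ holds, else 0; entries with $\chi=0$ are $0$. -}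

module Defs where

open import Data.Nat as ℕ using (ℕ; zero; suc; _<_; _≤?_; _∸_)
open import Data.Integer using (+_)
open import Data.Rational using (ℚ; 0ℚ; 1ℚ; -_; _/_) renaming (_+_ to _+ℚ_; _*_ to _*ℚ_)
open import Data.List using (List; []; _∷_; _++_; map; length; foldr)
open import Data.Nat.ListAction using (sum; product)
open import Data.List.Relation.Unary.All using (All)
open import Data.List.Properties using (≡-dec)
open import Data.Maybe using (Maybe; just; nothing)
open import Data.Product using (_×_; _,_)
open import Relation.Nullary using (yes; no)
open import Relation.Binary.PropositionalEquality using (_≡_)

IsComp : ℕ → List ℕ → Set
IsComp n α = All (λ a → 0 < a) α × sum α ≡ n

-- Explicit enumeration of C(n) (each composition exactly once):
-- compositions of n+2 arise from those of n+1 either by prepending a part 1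
-- or by increasing the first part by 1.
incHead : List ℕ → List ℕ
incHead []      = []
incHead (a ∷ α) = suc a ∷ α

comps : ℕ → List (List ℕ)
comps zero          = [] ∷ []
comps (suc zero)    = (1 ∷ []) ∷ []
comps (suc (suc n)) = map (1 ∷_) (comps (suc n)) ++ map incHead (comps (suc n))

takeBlock : List ℕ → ℕ → Maybe (List ℕ × List ℕ)
takeBlock β zero = just ([] , β)
takeBlock [] (suc a) = nothing
takeBlock (b ∷ β) (suc a) with b ≤? suc a
... | no _ = nothing
... | yes _ with takeBlock β (suc a ∸ b)
...   | nothing = nothing
...   | just (blk , rest) = just (b ∷ blk , rest)

-- blocks β α = just (β^(1), …, β^(ℓ(α))) if β ≤ α (β refines α), else nothing.
-- (For compositions β, α this is exactly the refinement relation of the paper,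
--  with the unique decomposition β = β^(1) ++ … ++ β^(ℓ(α)), sum β^(k) = α_k.)
blocks : List ℕ → List ℕ → Maybe (List (List ℕ))
blocks [] [] = just []
blocks (_ ∷ _) [] = nothing
blocks β (a ∷ α) with takeBlock β a
... | nothing = nothing
... | just (blk , rest) with blocks rest α
...   | nothing = nothing
...   | just bs = just (blk ∷ bs)

-- Z_γ = γ₁ (γ₁+γ₂) ⋯ (γ₁+⋯+γ_s)
Zaux : ℕ → List ℕ → ℕ
Zaux acc [] = 1
Zaux acc (g ∷ γ) = (acc ℕ.+ g) ℕ.* Zaux (acc ℕ.+ g) γ

Z : List ℕ → ℕ
Z γ = Zaux 0 γ

-- last part L(γ) (γ nonempty in all uses)
lastPart : List ℕ → ℕ
lastPart [] = 0
lastPart (a ∷ []) = a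
lastPart (_ ∷ b ∷ γ) = lastPart (b ∷ γ)

-- 1/k in ℚ (only applied to k > 0)
invℚ : ℕ → ℚ
invℚ zero = 0ℚ
invℚ (suc k) = + 1 / suc k

signℚ : ℕ → ℚ
signℚ zero = 1ℚ
signℚ (suc k) = - signℚ k

Aentry : List ℕ → List ℕ → ℚ
Aentry lam β with blocks lam β
... | nothing = 0ℚ
... | just bs = + product (map lastPart bs) / 1

Bentry : List ℕ → List ℕ → ℚ
Bentry β μ with blocks β μ
... | nothing = 0ℚ
... | just bs = signℚ (length β ∸ length μ) *ℚ invℚ (product (map Z bs))

sumℚ : List ℚ → ℚ
sumℚ = foldr _+ℚ_ 0ℚ

matMul : ℕ → (List ℕ → List ℕ → ℚ) → (List ℕ → List ℕ → ℚ) → List ℕ → List ℕ → ℚ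
matMul n M N x y = sumℚ (map (λ β → M x β *ℚ N β y) (comps n))

δ : List ℕ → List ℕ → ℚ
δ x y with ≡-dec ℕ._≟_ x y
... | yes _ = 1ℚ
... | no _  = 0ℚ

-- Encode a composition of n + 1 by its word of cuts w ∈ {true, false}ⁿ; then λ ≤ β iff every cut
-- of β is a cut of λ.  Reading the words from left to right, the entries of A and B become products
-- of local factors: A(λ, β) collects the size of the current part of λ at every cut of β and at the
-- end, and B(β, μ) collects −1/s at every cut of β that is not a cut of μ and 1/s at every cut of μ
-- and at the end, s being the position inside the current block of μ.  Splitting the sum over the middle
-- composition according to its first letter gives a recursion on n.  Its only non-trivial case is a
-- first cut of the left word that is not one of the right word: there the two halves of the sum are
-- equal up to sign (and for B A both are ±1/s times the identity), so they cancel.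

module Submission where

open import Defs
open import Data.Bool using (Bool; true; false)
open import Data.Integer using (+_)
import Data.Integer.Properties as ℤ
open import Data.List using (List; []; _∷_; _++_; map; length)
import Data.List.Properties as List
open import Data.List.Relation.Unary.All using (All; []; _∷_)
open import Data.Maybe using (Maybe; just; nothing)
import Data.Maybe as Maybe
open import Data.Nat using (ℕ; zero; suc; _+_; _*_; _∸_; _<_; _≤?_; _≟_; z<s)
import Data.Nat.Properties as ℕ
open import Data.Nat.ListAction using (sum; product)
open import Data.Product using (_×_; ∃; ∃₂; _,_; map₁)
open import Data.Rational using (ℚ; 0ℚ; 1ℚ; -_; _/_; fromℚᵘ; toℚᵘ)
  renaming (_+_ to _+ℚ_; _*_ to _*ℚ_)
import Data.Rational.Properties as ℚ
open import Data.Rational.Solver using (module +-*-Solver)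
open import Data.Rational.Unnormalised using (mkℚᵘ) renaming (_*_ to _*ᵘ_)
import Data.Rational.Unnormalised.Properties as ℚᵘ
open import Data.Vec using (Vec; []; _∷_)
open import Function using (_∘_)
open import Relation.Binary.PropositionalEquality
open import Relation.Nullary using (yes; no; contradiction)

open ≡-Reasoning
open +-*-Solver using (solve; _:*_; :-_; _:=_)

fromℕ : ℕ → ℚ
fromℕ n = + n / 1

fromℚᵘ-homo-* : ∀ p q → fromℚᵘ (p *ᵘ q) ≡ fromℚᵘ p *ℚ fromℚᵘ q
fromℚᵘ-homo-* p q = begin
  fromℚᵘ (p *ᵘ q)
    ≡⟨ ℚ.fromℚᵘ-cong (ℚᵘ.*-cong (ℚᵘ.≃-sym (ℚ.toℚᵘ-fromℚᵘ p)) (ℚᵘ.≃-sym (ℚ.toℚᵘ-fromℚᵘ q))) ⟩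
  fromℚᵘ (toℚᵘ (fromℚᵘ p) *ᵘ toℚᵘ (fromℚᵘ q))
    ≡⟨ ℚ.fromℚᵘ-cong (ℚᵘ.≃-sym (ℚ.toℚᵘ-homo-* (fromℚᵘ p) (fromℚᵘ q))) ⟩
  fromℚᵘ (toℚᵘ (fromℚᵘ p *ℚ fromℚᵘ q))
    ≡⟨ ℚ.fromℚᵘ-toℚᵘ (fromℚᵘ p *ℚ fromℚᵘ q) ⟩
  fromℚᵘ p *ℚ fromℚᵘ q ∎

fromℕ-homo-* : ∀ m n → fromℕ (m * n) ≡ fromℕ m *ℚ fromℕ n
fromℕ-homo-* m n = trans (cong (λ i → fromℚᵘ (mkℚᵘ i 0)) (ℤ.pos-* m n))
                         (fromℚᵘ-homo-* (mkℚᵘ (+ m) 0) (mkℚᵘ (+ n) 0))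

invℚ-homo-* : ∀ m n → invℚ (m * n) ≡ invℚ m *ℚ invℚ n
invℚ-homo-* zero    n       = sym (ℚ.*-zeroˡ (invℚ n))
invℚ-homo-* (suc m) zero    = trans (cong invℚ (ℕ.*-zeroʳ m)) (sym (ℚ.*-zeroʳ (invℚ (suc m))))
invℚ-homo-* (suc m) (suc n) = fromℚᵘ-homo-* (mkℚᵘ (+ 1) m) (mkℚᵘ (+ 1) n)

fromℕ-*-invℚ : ∀ n → fromℕ (suc n) *ℚ invℚ (suc n) ≡ 1ℚ
fromℕ-*-invℚ n = trans (sym (fromℚᵘ-homo-* (mkℚᵘ (+ suc n) 0) (mkℚᵘ (+ 1) n)))
                       (ℚ.fromℚᵘ-cong (ℚᵘ.*-inverseʳ (mkℚᵘ (+ suc n) 0)))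

fromℕ-*-invℚ-cancel : ∀ c a r → fromℕ (suc c * a) *ℚ (invℚ (suc c) *ℚ r) ≡ fromℕ a *ℚ r
fromℕ-*-invℚ-cancel c a r = begin
  fromℕ (suc c * a) *ℚ (i *ℚ r)     ≡⟨ cong (_*ℚ (i *ℚ r)) (fromℕ-homo-* (suc c) a) ⟩
  (k *ℚ fromℕ a) *ℚ (i *ℚ r)        ≡⟨ solve 4 (λ k a i r → (k :* a) :* (i :* r) := (k :* i) :* (a :* r))
                                              refl k (fromℕ a) i r ⟩
  (k *ℚ i) *ℚ (fromℕ a *ℚ r)        ≡⟨ cong (_*ℚ (fromℕ a *ℚ r)) (fromℕ-*-invℚ c) ⟩
  1ℚ *ℚ (fromℕ a *ℚ r)              ≡⟨ ℚ.*-identityˡ (fromℕ a *ℚ r) ⟩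
  fromℕ a *ℚ r                      ∎
  where
  k = fromℕ (suc c)
  i = invℚ (suc c)

words : (n : ℕ) → List (Vec Bool n)
words zero    = [] ∷ []
words (suc n) = map (true ∷_) (words n) ++ map (false ∷_) (words n)

∑ : ∀ {A : Set} → List A → (A → ℚ) → ℚ
∑ xs f = sumℚ (map f xs)

infix 5 ∑
syntax ∑ xs (λ x → e) = ∑[ x ← xs ] e

module _ {A : Set} where

  ∑-++ : ∀ xs ys (f : A → ℚ) → ∑ (xs ++ ys) f ≡ ∑ xs f +ℚ ∑ ys f
  ∑-++ []       ys f = sym (ℚ.+-identityˡ (∑ ys f))
  ∑-++ (x ∷ xs) ys f = trans (cong (f x +ℚ_) (∑-++ xs ys f)) (sym (ℚ.+-assoc (f x) (∑ xs f) (∑ ys f)))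

  ∑-map : ∀ {B : Set} (g : B → A) xs (f : A → ℚ) → ∑ (map g xs) f ≡ ∑ xs (f ∘ g)
  ∑-map g xs f = cong sumℚ (sym (List.map-∘ xs))

  ∑-cong : ∀ xs {f g : A → ℚ} → (∀ x → f x ≡ g x) → ∑ xs f ≡ ∑ xs g
  ∑-cong xs f≡g = cong sumℚ (List.map-cong f≡g xs)

  ∑-zero : ∀ xs {f : A → ℚ} → (∀ x → f x ≡ 0ℚ) → ∑ xs f ≡ 0ℚ
  ∑-zero []       f≡0 = refl
  ∑-zero (x ∷ xs) f≡0 = cong₂ _+ℚ_ (f≡0 x) (∑-zero xs f≡0)

  ∑-neg : ∀ xs (f : A → ℚ) → ∑[ x ← xs ] - f x ≡ - ∑ xs f
  ∑-neg []       f = refl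
  ∑-neg (x ∷ xs) f = trans (cong (- f x +ℚ_) (∑-neg xs f)) (sym (ℚ.neg-distrib-+ (f x) (∑ xs f)))

  ∑-scale : ∀ xs k (f : A → ℚ) → ∑[ x ← xs ] k *ℚ f x ≡ k *ℚ ∑ xs f
  ∑-scale []       k f = sym (ℚ.*-zeroʳ k)
  ∑-scale (x ∷ xs) k f = trans (cong (k *ℚ f x +ℚ_) (∑-scale xs k f))
                               (sym (ℚ.*-distribˡ-+ k (f x) (∑ xs f)))

∑-words-suc : ∀ n (f : Vec Bool (suc n) → ℚ) →
              ∑ (words (suc n)) f ≡ ∑ (words n) (f ∘ (true ∷_)) +ℚ ∑ (words n) (f ∘ (false ∷_))
∑-words-suc n f = trans (∑-++ (map (true ∷_) (words n)) (map (false ∷_) (words n)) f)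
                        (cong₂ _+ℚ_ (∑-map (true ∷_) (words n) f) (∑-map (false ∷_) (words n) f))

-- fromCuts c w is the composition of c + 1 + n whose parts end exactly after the positions i
-- with wᵢ = true (and at the end), its first part being enlarged by c.
fromCuts : ∀ {n} → ℕ → Vec Bool n → List ℕ
fromCuts c []          = suc c ∷ []
fromCuts c (true ∷ w)  = suc c ∷ fromCuts 0 w
fromCuts c (false ∷ w) = fromCuts (suc c) w

numCuts : ∀ {n} → Vec Bool n → ℕ
numCuts []          = 0
numCuts (true ∷ w)  = suc (numCuts w)
numCuts (false ∷ w) = numCuts w

fromCuts-shape : ∀ {n} (w : Vec Bool n) → ∃₂ λ h T → ∀ c → fromCuts c w ≡ c + suc h ∷ T
fromCuts-shape []          = 0 , [] , λ c → cong (_∷ []) (ℕ.+-comm 1 c)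
fromCuts-shape (true ∷ w)  = 0 , fromCuts 0 w , λ c → cong (_∷ fromCuts 0 w) (ℕ.+-comm 1 c)
fromCuts-shape (false ∷ w) with fromCuts-shape w
... | h , T , shape = suc h , T , λ c → trans (shape (suc c)) (cong (_∷ T) (sym (ℕ.+-suc c (suc h))))

length-fromCuts : ∀ {n} c (w : Vec Bool n) → length (fromCuts c w) ≡ suc (numCuts w)
length-fromCuts c []          = refl
length-fromCuts c (true ∷ w)  = cong suc (length-fromCuts 0 w)
length-fromCuts c (false ∷ w) = length-fromCuts (suc c) w

incHead-fromCuts : ∀ {n} c (w : Vec Bool n) → incHead (fromCuts c w) ≡ fromCuts (suc c) w
incHead-fromCuts c []          = refl
incHead-fromCuts c (true ∷ w)  = refl
incHead-fromCuts c (false ∷ w) = incHead-fromCuts (suc c) w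

comps-suc : ∀ n → comps (suc n) ≡ map (fromCuts 0) (words n)
comps-suc zero    = refl
comps-suc (suc n) = begin
  map (1 ∷_) (comps (suc n)) ++ map incHead (comps (suc n))
    ≡⟨ cong (λ cs → map (1 ∷_) cs ++ map incHead cs) (comps-suc n) ⟩
  map (1 ∷_) (map (fromCuts 0) W) ++ map incHead (map (fromCuts 0) W)
    ≡⟨ cong₂ _++_ (sym (List.map-∘ W))
                  (trans (sym (List.map-∘ W)) (List.map-cong (incHead-fromCuts 0) W)) ⟩
  map (fromCuts 0 ∘ (true ∷_)) W ++ map (fromCuts 0 ∘ (false ∷_)) W
    ≡⟨ cong₂ _++_ (List.map-∘ W) (List.map-∘ W) ⟩
  map (fromCuts 0) (map (true ∷_) W) ++ map (fromCuts 0) (map (false ∷_) W)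
    ≡⟨ List.map-++ (fromCuts 0) (map (true ∷_) W) (map (false ∷_) W) ⟨
  map (fromCuts 0) (words (suc n)) ∎
  where W = words n

cut≢fromCuts-suc : ∀ {n} c X (u : Vec Bool n) → suc c ∷ X ≢ fromCuts (suc c) u
cut≢fromCuts-suc c X u eq with fromCuts-shape u
... | h , T , shape =
  ℕ.<⇒≢ (ℕ.m<m+n (suc c) z<s) (List.∷-injectiveˡ (trans eq (shape (suc c))))

fromCuts-injective : ∀ {n} c (w u : Vec Bool n) → fromCuts c w ≡ fromCuts c u → w ≡ u
fromCuts-injective c []          []          eq = refl
fromCuts-injective c (true ∷ w)  (true ∷ u)  eq =
  cong (true ∷_) (fromCuts-injective 0 w u (List.∷-injectiveʳ eq))
fromCuts-injective c (true ∷ w)  (false ∷ u) eq = contradiction eq (cut≢fromCuts-suc c _ u)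
fromCuts-injective c (false ∷ w) (true ∷ u)  eq = contradiction (sym eq) (cut≢fromCuts-suc c _ w)
fromCuts-injective c (false ∷ w) (false ∷ u) eq = cong (false ∷_) (fromCuts-injective (suc c) w u eq)

fromCuts-surjective′ : ∀ c a x → All (0 <_) x →
                       ∃ λ (w : Vec Bool (a + sum x)) → fromCuts c w ≡ suc (c + a) ∷ x
fromCuts-surjective′ c zero    []          []        =
  [] , cong (λ m → suc m ∷ []) (sym (ℕ.+-identityʳ c))
fromCuts-surjective′ c zero    (suc b ∷ x) (_ ∷ x>0) with fromCuts-surjective′ 0 b x x>0
... | w , eq = true ∷ w , cong₂ (λ m y → suc m ∷ y) (sym (ℕ.+-identityʳ c)) eq
fromCuts-surjective′ c (suc a) x           x>0       with fromCuts-surjective′ (suc c) a x x>0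
... | w , eq = false ∷ w , trans eq (cong (λ m → suc m ∷ x) (sym (ℕ.+-suc c a)))

fromCuts-surjective : ∀ {n x} → IsComp (suc n) x → ∃ λ (w : Vec Bool n) → fromCuts 0 w ≡ x
fromCuts-surjective {x = []}        (_ , ())
fromCuts-surjective {x = suc a ∷ x} (_ ∷ x>0 , sum≡) =
  subst (λ m → ∃ λ (w : Vec Bool m) → fromCuts 0 w ≡ suc a ∷ x)
        (ℕ.suc-injective sum≡) (fromCuts-surjective′ 0 a x x>0)

IsComp-zero : ∀ {x} → IsComp 0 x → x ≡ []
IsComp-zero {[]}        _       = refl
IsComp-zero {zero ∷ x}  (() ∷ _ , _)
IsComp-zero {suc a ∷ x} (_ , ())

blocksFrom : Maybe (List ℕ × List ℕ) → List ℕ → Maybe (List (List ℕ))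
blocksFrom nothing             α = nothing
blocksFrom (just (blk , rest)) α = Maybe.map (blk ∷_) (blocks rest α)

blocks-∷ : ∀ β a α → blocks β (a ∷ α) ≡ blocksFrom (takeBlock β a) α
blocks-∷ [] a α with takeBlock [] a
... | nothing = refl
... | just (blk , rest) with blocks rest α
...   | nothing = refl
...   | just _  = refl
blocks-∷ (b ∷ β) a α with takeBlock (b ∷ β) a
... | nothing = refl
... | just (blk , rest) with blocks rest α
...   | nothing = refl
...   | just _  = refl

takeBlock-∷ : ∀ c β k → takeBlock (suc c ∷ β) (suc c + k) ≡ Maybe.map (map₁ (suc c ∷_)) (takeBlock β k)
takeBlock-∷ c β k with suc c ≤? suc c + k
... | no  c≰c+k = contradiction (ℕ.m≤m+n (suc c) k) c≰c+k
... | yes _ rewrite ℕ.m+n∸m≡n c k with takeBlock β k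
...   | nothing = refl
...   | just _  = refl

takeBlock-overshoot : ∀ {a b} β → suc a < b → takeBlock (b ∷ β) (suc a) ≡ nothing
takeBlock-overshoot {a} {b} β a<b with b ≤? suc a
... | no  _   = refl
... | yes b≤a = contradiction b≤a (ℕ.<⇒≱ a<b)

-- Only the first block sees the state s, so that weights can be evaluated from inside a block.
blockWeight : (ℕ → List ℕ → ℕ) → ℕ → Maybe (List (List ℕ)) → ℕ
blockWeight f s nothing          = 0
blockWeight f s (just [])        = 1
blockWeight f s (just (b ∷ bs))  = f s b * blockWeight f 0 (just bs)

blockWeight-just : ∀ f bs → blockWeight f 0 (just bs) ≡ product (map (f 0) bs)
blockWeight-just f []       = refl
blockWeight-just f (b ∷ bs) = cong (f 0 b *_) (blockWeight-just f bs)

blockWeight-∷ : ∀ f s b m → blockWeight f s (Maybe.map (b ∷_) m) ≡ f s b * blockWeight f 0 m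
blockWeight-∷ f s b nothing   = sym (ℕ.*-zeroʳ (f s b))
blockWeight-∷ f s b (just bs) = refl

blockWeight-sameHead : ∀ f s c X Y →
  blockWeight f s (blocks (suc c ∷ X) (suc c ∷ Y)) ≡ f s (suc c ∷ []) * blockWeight f 0 (blocks X Y)
blockWeight-sameHead f s c X Y = begin
  blockWeight f s (blocks (suc c ∷ X) (suc c ∷ Y))
    ≡⟨ cong (blockWeight f s) (blocks-∷ (suc c ∷ X) (suc c) Y) ⟩
  blockWeight f s (blocksFrom (takeBlock (suc c ∷ X) (suc c)) Y)
    ≡⟨ cong (λ t → blockWeight f s (blocksFrom t Y)) takeBlock-head ⟩
  blockWeight f s (Maybe.map ((suc c ∷ []) ∷_) (blocks X Y))
    ≡⟨ blockWeight-∷ f s (suc c ∷ []) (blocks X Y) ⟩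
  f s (suc c ∷ []) * blockWeight f 0 (blocks X Y) ∎
  where
  takeBlock-head : takeBlock (suc c ∷ X) (suc c) ≡ just (suc c ∷ [] , X)
  takeBlock-head = trans (cong (takeBlock (suc c ∷ X)) (sym (ℕ.+-identityʳ (suc c)))) (takeBlock-∷ c X 0)

blockWeight-extendHead : ∀ f {s s′ k} c X h Y → (∀ b → f s (suc c ∷ b) ≡ k * f s′ b) →
  blockWeight f s (blocks (suc c ∷ X) (suc c + h ∷ Y)) ≡ k * blockWeight f s′ (blocks X (h ∷ Y))
blockWeight-extendHead f {s} {s′} {k} c X h Y shift = begin
  blockWeight f s (blocks (suc c ∷ X) (suc c + h ∷ Y))
    ≡⟨ cong (blockWeight f s) (blocks-∷ (suc c ∷ X) (suc c + h) Y) ⟩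
  blockWeight f s (blocksFrom (takeBlock (suc c ∷ X) (suc c + h)) Y)
    ≡⟨ cong (λ t → blockWeight f s (blocksFrom t Y)) (takeBlock-∷ c X h) ⟩
  blockWeight f s (blocksFrom (Maybe.map (map₁ (suc c ∷_)) (takeBlock X h)) Y)
    ≡⟨ extend (takeBlock X h) ⟩
  k * blockWeight f s′ (blocksFrom (takeBlock X h) Y)
    ≡⟨ cong (λ m → k * blockWeight f s′ m) (blocks-∷ X h Y) ⟨
  k * blockWeight f s′ (blocks X (h ∷ Y)) ∎
  where
  extend : ∀ t → blockWeight f s (blocksFrom (Maybe.map (map₁ (suc c ∷_)) t) Y)
                 ≡ k * blockWeight f s′ (blocksFrom t Y)
  extend nothing             = sym (ℕ.*-zeroʳ k)
  extend (just (blk , rest)) = begin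
    blockWeight f s (Maybe.map ((suc c ∷ blk) ∷_) (blocks rest Y))
      ≡⟨ blockWeight-∷ f s (suc c ∷ blk) (blocks rest Y) ⟩
    f s (suc c ∷ blk) * blockWeight f 0 (blocks rest Y)
      ≡⟨ cong (_* blockWeight f 0 (blocks rest Y)) (shift blk) ⟩
    k * f s′ blk * blockWeight f 0 (blocks rest Y)
      ≡⟨ ℕ.*-assoc k (f s′ blk) (blockWeight f 0 (blocks rest Y)) ⟩
    k * (f s′ blk * blockWeight f 0 (blocks rest Y))
      ≡⟨ cong (k *_) (blockWeight-∷ f s′ blk (blocks rest Y)) ⟨
    k * blockWeight f s′ (Maybe.map (blk ∷_) (blocks rest Y)) ∎

blockWeight-extendHead-fromCuts : ∀ {n} f {s s′ k} c X (v : Vec Bool n) →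
  (∀ b → f s (suc c ∷ b) ≡ k * f s′ b) →
  blockWeight f s (blocks (suc c ∷ X) (fromCuts (suc c) v))
  ≡ k * blockWeight f s′ (blocks X (fromCuts 0 v))
blockWeight-extendHead-fromCuts f {s} {s′} {k} c X v shift with fromCuts-shape v
... | h , T , shape rewrite shape (suc c) | shape 0 =
  blockWeight-extendHead f {s} {s′} {k} c X (suc h) T shift

blocks-fromCuts-overshoot : ∀ {n} c (w : Vec Bool n) Y →
                            blocks (fromCuts (suc c) w) (suc c ∷ Y) ≡ nothing
blocks-fromCuts-overshoot c w Y with fromCuts-shape w
... | h , T , shape rewrite shape (suc c) =
  trans (blocks-∷ (suc c + suc h ∷ T) (suc c) Y)
        (cong (λ t → blocksFrom t Y) (takeBlock-overshoot T (ℕ.m<m+n (suc c) z<s)))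

lastOr : ℕ → List ℕ → ℕ
lastOr d []      = d
lastOr d (a ∷ γ) = lastOr a γ

lastPart≡lastOr0 : ∀ γ → lastPart γ ≡ lastOr 0 γ
lastPart≡lastOr0 []          = refl
lastPart≡lastOr0 (a ∷ [])    = refl
lastPart≡lastOr0 (a ∷ b ∷ γ) = lastPart≡lastOr0 (b ∷ γ)

Aentry≡blockWeight : ∀ γ β → Aentry γ β ≡ fromℕ (blockWeight lastOr 0 (blocks γ β))
Aentry≡blockWeight γ β with blocks γ β
... | nothing = refl
... | just bs = cong fromℕ (trans (cong product (List.map-cong lastPart≡lastOr0 bs))
                                  (sym (blockWeight-just lastOr bs)))

Bentry≡blockWeight : ∀ β μ →
  Bentry β μ ≡ signℚ (length β ∸ length μ) *ℚ invℚ (blockWeight Zaux 0 (blocks β μ))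
Bentry≡blockWeight β μ with blocks β μ
... | nothing = sym (ℚ.*-zeroʳ (signℚ (length β ∸ length μ)))
... | just bs = cong (λ z → signℚ (length β ∸ length μ) *ℚ invℚ z) (sym (blockWeight-just Zaux bs))

-- A, Z and B between the compositions with cut words w and v, read from the left: c + 1 is the
-- size of the current part of the finer composition, e + 1 the position inside the current block
-- of the coarser one.
cutA : ∀ {n} → ℕ → Vec Bool n → Vec Bool n → ℕ
cutA c []          []          = suc c
cutA c (true ∷ w)  (true ∷ v)  = suc c * cutA 0 w v
cutA c (true ∷ w)  (false ∷ v) = cutA 0 w v
cutA c (false ∷ w) (true ∷ v)  = 0
cutA c (false ∷ w) (false ∷ v) = cutA (suc c) w v

cutZ : ∀ {n} → ℕ → Vec Bool n → Vec Bool n → ℕ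
cutZ e []          []          = suc e
cutZ e (true ∷ w)  (true ∷ v)  = suc e * cutZ 0 w v
cutZ e (true ∷ w)  (false ∷ v) = suc e * cutZ (suc e) w v
cutZ e (false ∷ w) (true ∷ v)  = 0
cutZ e (false ∷ w) (false ∷ v) = cutZ (suc e) w v

cutB : ∀ {n} → ℕ → Vec Bool n → Vec Bool n → ℚ
cutB e []          []          = invℚ (suc e)
cutB e (true ∷ w)  (true ∷ v)  = invℚ (suc e) *ℚ cutB 0 w v
cutB e (true ∷ w)  (false ∷ v) = - (invℚ (suc e) *ℚ cutB (suc e) w v)
cutB e (false ∷ w) (true ∷ v)  = 0ℚ
cutB e (false ∷ w) (false ∷ v) = cutB (suc e) w v

blockWeight-lastOr-fromCuts : ∀ {n} d c (w v : Vec Bool n) →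
  blockWeight lastOr d (blocks (fromCuts c w) (fromCuts c v)) ≡ cutA c w v
blockWeight-lastOr-fromCuts d c [] [] =
  trans (blockWeight-sameHead lastOr d c [] []) (ℕ.*-identityʳ (suc c))
blockWeight-lastOr-fromCuts d c (true ∷ w) (true ∷ v) =
  trans (blockWeight-sameHead lastOr d c (fromCuts 0 w) (fromCuts 0 v))
        (cong (suc c *_) (blockWeight-lastOr-fromCuts 0 0 w v))
blockWeight-lastOr-fromCuts d c (true ∷ w) (false ∷ v) = begin
  blockWeight lastOr d (blocks (suc c ∷ fromCuts 0 w) (fromCuts (suc c) v))
    ≡⟨ blockWeight-extendHead-fromCuts lastOr {d} {suc c} {1} c (fromCuts 0 w) v
                                       (λ b → sym (ℕ.*-identityˡ (lastOr (suc c) b))) ⟩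
  1 * blockWeight lastOr (suc c) (blocks (fromCuts 0 w) (fromCuts 0 v))
    ≡⟨ ℕ.*-identityˡ _ ⟩
  blockWeight lastOr (suc c) (blocks (fromCuts 0 w) (fromCuts 0 v))
    ≡⟨ blockWeight-lastOr-fromCuts (suc c) 0 w v ⟩
  cutA 0 w v ∎
blockWeight-lastOr-fromCuts d c (false ∷ w) (true ∷ v) =
  cong (blockWeight lastOr d) (blocks-fromCuts-overshoot c w (fromCuts 0 v))
blockWeight-lastOr-fromCuts d c (false ∷ w) (false ∷ v) = blockWeight-lastOr-fromCuts d (suc c) w v

blockWeight-Zaux-fromCuts : ∀ {n} acc c (w v : Vec Bool n) →
  blockWeight Zaux acc (blocks (fromCuts c w) (fromCuts c v)) ≡ cutZ (c + acc) w v
blockWeight-Zaux-fromCuts acc c [] [] = begin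
  blockWeight Zaux acc (blocks (suc c ∷ []) (suc c ∷ []))
    ≡⟨ blockWeight-sameHead Zaux acc c [] [] ⟩
  (acc + suc c) * 1 * 1
    ≡⟨ trans (ℕ.*-identityʳ _) (ℕ.*-identityʳ _) ⟩
  acc + suc c
    ≡⟨ ℕ.+-comm acc (suc c) ⟩
  suc (c + acc) ∎
blockWeight-Zaux-fromCuts acc c (true ∷ w) (true ∷ v) = begin
  blockWeight Zaux acc (blocks (suc c ∷ fromCuts 0 w) (suc c ∷ fromCuts 0 v))
    ≡⟨ blockWeight-sameHead Zaux acc c (fromCuts 0 w) (fromCuts 0 v) ⟩
  (acc + suc c) * 1 * blockWeight Zaux 0 (blocks (fromCuts 0 w) (fromCuts 0 v))
    ≡⟨ cong₂ _*_ (trans (ℕ.*-identityʳ _) (ℕ.+-comm acc (suc c)))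
                 (blockWeight-Zaux-fromCuts 0 0 w v) ⟩
  suc (c + acc) * cutZ 0 w v ∎
blockWeight-Zaux-fromCuts acc c (true ∷ w) (false ∷ v) = begin
  blockWeight Zaux acc (blocks (suc c ∷ fromCuts 0 w) (fromCuts (suc c) v))
    ≡⟨ blockWeight-extendHead-fromCuts Zaux {acc} {acc + suc c} {acc + suc c} c (fromCuts 0 w) v
                                       (λ b → refl) ⟩
  (acc + suc c) * blockWeight Zaux (acc + suc c) (blocks (fromCuts 0 w) (fromCuts 0 v))
    ≡⟨ cong ((acc + suc c) *_) (blockWeight-Zaux-fromCuts (acc + suc c) 0 w v) ⟩
  (acc + suc c) * cutZ (acc + suc c) w v
    ≡⟨ cong (λ e → e * cutZ e w v) (ℕ.+-comm acc (suc c)) ⟩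
  suc (c + acc) * cutZ (suc (c + acc)) w v ∎
blockWeight-Zaux-fromCuts acc c (false ∷ w) (true ∷ v) =
  cong (blockWeight Zaux acc) (blocks-fromCuts-overshoot c w (fromCuts 0 v))
blockWeight-Zaux-fromCuts acc c (false ∷ w) (false ∷ v) = blockWeight-Zaux-fromCuts acc (suc c) w v

-- The offset k absorbs each cut of w alone, so no truncated subtraction ever has to be undone.
signℚ-invℚ-cutZ : ∀ {n} k e (w v : Vec Bool n) →
  signℚ (k + numCuts w ∸ numCuts v) *ℚ invℚ (cutZ e w v) ≡ signℚ k *ℚ cutB e w v
signℚ-invℚ-cutZ k e [] [] = cong (λ m → signℚ m *ℚ invℚ (suc e)) (ℕ.+-identityʳ k)
signℚ-invℚ-cutZ k e (true ∷ w) (true ∷ v) = begin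
  signℚ (k + suc (numCuts w) ∸ suc (numCuts v)) *ℚ invℚ (suc e * cutZ 0 w v)
    ≡⟨ cong₂ (λ m z → signℚ (m ∸ suc (numCuts v)) *ℚ z)
             (ℕ.+-suc k (numCuts w)) (invℚ-homo-* (suc e) (cutZ 0 w v)) ⟩
  s *ℚ (i *ℚ invℚ (cutZ 0 w v))
    ≡⟨ solve 3 (λ s i z → s :* (i :* z) := i :* (s :* z)) refl s i (invℚ (cutZ 0 w v)) ⟩
  i *ℚ (s *ℚ invℚ (cutZ 0 w v))
    ≡⟨ cong (i *ℚ_) (signℚ-invℚ-cutZ k 0 w v) ⟩
  i *ℚ (signℚ k *ℚ cutB 0 w v)
    ≡⟨ solve 3 (λ i s b → i :* (s :* b) := s :* (i :* b)) refl i (signℚ k) (cutB 0 w v) ⟩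
  signℚ k *ℚ (i *ℚ cutB 0 w v) ∎
  where
  s = signℚ (k + numCuts w ∸ numCuts v)
  i = invℚ (suc e)
signℚ-invℚ-cutZ k e (true ∷ w) (false ∷ v) = begin
  signℚ (k + suc (numCuts w) ∸ numCuts v) *ℚ invℚ (suc e * cutZ (suc e) w v)
    ≡⟨ cong₂ (λ m z → signℚ (m ∸ numCuts v) *ℚ z)
             (ℕ.+-suc k (numCuts w)) (invℚ-homo-* (suc e) (cutZ (suc e) w v)) ⟩
  s *ℚ (i *ℚ invℚ (cutZ (suc e) w v))
    ≡⟨ solve 3 (λ s i z → s :* (i :* z) := i :* (s :* z)) refl s i (invℚ (cutZ (suc e) w v)) ⟩
  i *ℚ (s *ℚ invℚ (cutZ (suc e) w v))
    ≡⟨ cong (i *ℚ_) (signℚ-invℚ-cutZ (suc k) (suc e) w v) ⟩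
  i *ℚ (- signℚ k *ℚ cutB (suc e) w v)
    ≡⟨ solve 3 (λ i s b → i :* (:- s :* b) := s :* (:- (i :* b)))
               refl i (signℚ k) (cutB (suc e) w v) ⟩
  signℚ k *ℚ - (i *ℚ cutB (suc e) w v) ∎
  where
  s = signℚ (suc k + numCuts w ∸ numCuts v)
  i = invℚ (suc e)
signℚ-invℚ-cutZ k e (false ∷ w) (true ∷ v) =
  trans (ℚ.*-zeroʳ (signℚ (k + numCuts w ∸ suc (numCuts v)))) (sym (ℚ.*-zeroʳ (signℚ k)))
signℚ-invℚ-cutZ k e (false ∷ w) (false ∷ v) = signℚ-invℚ-cutZ k (suc e) w v

Aentry-fromCuts : ∀ {n} (w v : Vec Bool n) → Aentry (fromCuts 0 w) (fromCuts 0 v) ≡ fromℕ (cutA 0 w v)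
Aentry-fromCuts w v =
  trans (Aentry≡blockWeight (fromCuts 0 w) (fromCuts 0 v))
        (cong fromℕ (blockWeight-lastOr-fromCuts 0 0 w v))

Bentry-fromCuts : ∀ {n} (w v : Vec Bool n) → Bentry (fromCuts 0 w) (fromCuts 0 v) ≡ cutB 0 w v
Bentry-fromCuts w v = begin
  Bentry (fromCuts 0 w) (fromCuts 0 v)
    ≡⟨ Bentry≡blockWeight (fromCuts 0 w) (fromCuts 0 v) ⟩
  signℚ (length (fromCuts 0 w) ∸ length (fromCuts 0 v))
    *ℚ invℚ (blockWeight Zaux 0 (blocks (fromCuts 0 w) (fromCuts 0 v)))
    ≡⟨ cong₂ (λ ℓ z → signℚ ℓ *ℚ invℚ z)
             (cong₂ _∸_ (length-fromCuts 0 w) (length-fromCuts 0 v))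
             (blockWeight-Zaux-fromCuts 0 0 w v) ⟩
  signℚ (numCuts w ∸ numCuts v) *ℚ invℚ (cutZ 0 w v)
    ≡⟨ signℚ-invℚ-cutZ 0 0 w v ⟩
  1ℚ *ℚ cutB 0 w v
    ≡⟨ ℚ.*-identityˡ (cutB 0 w v) ⟩
  cutB 0 w v ∎

cutδ : ∀ {n} → Vec Bool n → Vec Bool n → ℚ
cutδ []          []          = 1ℚ
cutδ (true ∷ w)  (true ∷ u)  = cutδ w u
cutδ (true ∷ w)  (false ∷ u) = 0ℚ
cutδ (false ∷ w) (true ∷ u)  = 0ℚ
cutδ (false ∷ w) (false ∷ u) = cutδ w u

cutδ-refl : ∀ {n} (w : Vec Bool n) → cutδ w w ≡ 1ℚ
cutδ-refl []          = refl
cutδ-refl (true ∷ w)  = cutδ-refl w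
cutδ-refl (false ∷ w) = cutδ-refl w

cutδ-≢ : ∀ {n} (w u : Vec Bool n) → w ≢ u → cutδ w u ≡ 0ℚ
cutδ-≢ []          []          w≢u = contradiction refl w≢u
cutδ-≢ (true ∷ w)  (true ∷ u)  w≢u = cutδ-≢ w u (w≢u ∘ cong (true ∷_))
cutδ-≢ (true ∷ w)  (false ∷ u) _   = refl
cutδ-≢ (false ∷ w) (true ∷ u)  _   = refl
cutδ-≢ (false ∷ w) (false ∷ u) w≢u = cutδ-≢ w u (w≢u ∘ cong (false ∷_))

δ-fromCuts : ∀ {n} (w u : Vec Bool n) → δ (fromCuts 0 w) (fromCuts 0 u) ≡ cutδ w u
δ-fromCuts w u with List.≡-dec _≟_ (fromCuts 0 w) (fromCuts 0 u)
... | yes eq rewrite fromCuts-injective 0 w u eq = sym (cutδ-refl u)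
... | no  ne = sym (cutδ-≢ w u (ne ∘ cong (fromCuts 0)))

cutA-cutB : ∀ {n} c (w u : Vec Bool n) → ∑[ v ← words n ] fromℕ (cutA c w v) *ℚ cutB c v u ≡ cutδ w u
cutA-cutB c [] [] = trans (ℚ.+-identityʳ _) (fromℕ-*-invℚ c)
cutA-cutB {suc n} c (true ∷ w) (true ∷ u) = begin
  ∑[ v ← words (suc n) ] fromℕ (cutA c (true ∷ w) v) *ℚ cutB c v (true ∷ u)
    ≡⟨ ∑-words-suc n _ ⟩
  (∑[ v ← words n ] fromℕ (suc c * cutA 0 w v) *ℚ (invℚ (suc c) *ℚ cutB 0 v u))
    +ℚ (∑[ v ← words n ] fromℕ (cutA 0 w v) *ℚ 0ℚ)
    ≡⟨ cong₂ _+ℚ_ (∑-cong (words n) λ v → fromℕ-*-invℚ-cancel c (cutA 0 w v) (cutB 0 v u))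
                  (∑-zero (words n) λ v → ℚ.*-zeroʳ (fromℕ (cutA 0 w v))) ⟩
  S +ℚ 0ℚ
    ≡⟨ ℚ.+-identityʳ S ⟩
  S
    ≡⟨ cutA-cutB 0 w u ⟩
  cutδ w u ∎
  where S = ∑[ v ← words n ] fromℕ (cutA 0 w v) *ℚ cutB 0 v u
cutA-cutB {suc n} c (true ∷ w) (false ∷ u) = begin
  ∑[ v ← words (suc n) ] fromℕ (cutA c (true ∷ w) v) *ℚ cutB c v (false ∷ u)
    ≡⟨ ∑-words-suc n _ ⟩
  (∑[ v ← words n ] fromℕ (suc c * cutA 0 w v) *ℚ - (invℚ (suc c) *ℚ cutB (suc c) v u)) +ℚ S
    ≡⟨ cong (_+ℚ S) (∑-cong (words n) λ v → cancel (cutA 0 w v) (cutB (suc c) v u)) ⟩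
  (∑[ v ← words n ] - (fromℕ (cutA 0 w v) *ℚ cutB (suc c) v u)) +ℚ S
    ≡⟨ cong (_+ℚ S) (∑-neg (words n) (λ v → fromℕ (cutA 0 w v) *ℚ cutB (suc c) v u)) ⟩
  - S +ℚ S
    ≡⟨ ℚ.+-inverseˡ S ⟩
  0ℚ ∎
  where
  S = ∑[ v ← words n ] fromℕ (cutA 0 w v) *ℚ cutB (suc c) v u
  cancel : ∀ a r → fromℕ (suc c * a) *ℚ - (invℚ (suc c) *ℚ r) ≡ - (fromℕ a *ℚ r)
  cancel a r = trans (sym (ℚ.neg-distribʳ-* (fromℕ (suc c * a)) (invℚ (suc c) *ℚ r)))
                     (cong -_ (fromℕ-*-invℚ-cancel c a r))
cutA-cutB {suc n} c (false ∷ w) (true ∷ u) = begin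
  ∑[ v ← words (suc n) ] fromℕ (cutA c (false ∷ w) v) *ℚ cutB c v (true ∷ u)
    ≡⟨ ∑-words-suc n _ ⟩
  (∑[ v ← words n ] 0ℚ *ℚ (invℚ (suc c) *ℚ cutB 0 v u))
    +ℚ (∑[ v ← words n ] fromℕ (cutA (suc c) w v) *ℚ 0ℚ)
    ≡⟨ cong₂ _+ℚ_ (∑-zero (words n) λ v → ℚ.*-zeroˡ (invℚ (suc c) *ℚ cutB 0 v u))
                  (∑-zero (words n) λ v → ℚ.*-zeroʳ (fromℕ (cutA (suc c) w v))) ⟩
  0ℚ ∎
cutA-cutB {suc n} c (false ∷ w) (false ∷ u) = begin
  ∑[ v ← words (suc n) ] fromℕ (cutA c (false ∷ w) v) *ℚ cutB c v (false ∷ u)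
    ≡⟨ ∑-words-suc n _ ⟩
  (∑[ v ← words n ] 0ℚ *ℚ - (invℚ (suc c) *ℚ cutB (suc c) v u)) +ℚ S
    ≡⟨ cong (_+ℚ S) (∑-zero (words n) λ v → ℚ.*-zeroˡ (- (invℚ (suc c) *ℚ cutB (suc c) v u))) ⟩
  0ℚ +ℚ S
    ≡⟨ ℚ.+-identityˡ S ⟩
  S
    ≡⟨ cutA-cutB (suc c) w u ⟩
  cutδ w u ∎
  where S = ∑[ v ← words n ] fromℕ (cutA (suc c) w v) *ℚ cutB (suc c) v u

cutB-cutA : ∀ {n} c (w u : Vec Bool n) → ∑[ v ← words n ] cutB c w v *ℚ fromℕ (cutA c v u) ≡ cutδ w u
cutB-cutA c [] [] =
  trans (ℚ.+-identityʳ _) (trans (ℚ.*-comm (invℚ (suc c)) _) (fromℕ-*-invℚ c))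
cutB-cutA {suc n} c (true ∷ w) (true ∷ u) = begin
  ∑[ v ← words (suc n) ] cutB c (true ∷ w) v *ℚ fromℕ (cutA c v (true ∷ u))
    ≡⟨ ∑-words-suc n _ ⟩
  (∑[ v ← words n ] (invℚ (suc c) *ℚ cutB 0 w v) *ℚ fromℕ (suc c * cutA 0 v u))
    +ℚ (∑[ v ← words n ] - (invℚ (suc c) *ℚ cutB (suc c) w v) *ℚ 0ℚ)
    ≡⟨ cong₂ _+ℚ_ (∑-cong (words n) λ v → cancel (cutB 0 w v) (cutA 0 v u))
                  (∑-zero (words n) λ v → ℚ.*-zeroʳ (- (invℚ (suc c) *ℚ cutB (suc c) w v))) ⟩
  S +ℚ 0ℚ
    ≡⟨ ℚ.+-identityʳ S ⟩
  S
    ≡⟨ cutB-cutA 0 w u ⟩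
  cutδ w u ∎
  where
  S = ∑[ v ← words n ] cutB 0 w v *ℚ fromℕ (cutA 0 v u)
  cancel : ∀ r a → (invℚ (suc c) *ℚ r) *ℚ fromℕ (suc c * a) ≡ r *ℚ fromℕ a
  cancel r a = trans (ℚ.*-comm (invℚ (suc c) *ℚ r) (fromℕ (suc c * a)))
                     (trans (fromℕ-*-invℚ-cancel c a r) (ℚ.*-comm (fromℕ a) r))
cutB-cutA {suc n} c (true ∷ w) (false ∷ u) = begin
  ∑[ v ← words (suc n) ] cutB c (true ∷ w) v *ℚ fromℕ (cutA c v (false ∷ u))
    ≡⟨ ∑-words-suc n _ ⟩
  (∑[ v ← words n ] (i *ℚ cutB 0 w v) *ℚ fromℕ (cutA 0 v u))
    +ℚ (∑[ v ← words n ] - (i *ℚ cutB (suc c) w v) *ℚ fromℕ (cutA (suc c) v u))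
    ≡⟨ cong₂ _+ℚ_ (∑-cong (words n) λ v → ℚ.*-assoc i (cutB 0 w v) (fromℕ (cutA 0 v u)))
                  (∑-cong (words n) λ v → neg-assoc (cutB (suc c) w v) (fromℕ (cutA (suc c) v u))) ⟩
  (∑[ v ← words n ] i *ℚ P₀ v) +ℚ (∑[ v ← words n ] - (i *ℚ P₁ v))
    ≡⟨ cong₂ _+ℚ_ (∑-scale (words n) i P₀)
                  (trans (∑-neg (words n) (λ v → i *ℚ P₁ v)) (cong -_ (∑-scale (words n) i P₁))) ⟩
  i *ℚ ∑ (words n) P₀ +ℚ - (i *ℚ ∑ (words n) P₁)
    ≡⟨ cong₂ (λ x y → i *ℚ x +ℚ - (i *ℚ y)) (cutB-cutA 0 w u) (cutB-cutA (suc c) w u) ⟩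
  i *ℚ cutδ w u +ℚ - (i *ℚ cutδ w u)
    ≡⟨ ℚ.+-inverseʳ (i *ℚ cutδ w u) ⟩
  0ℚ ∎
  where
  i = invℚ (suc c)
  P₀ P₁ : Vec Bool n → ℚ
  P₀ v = cutB 0 w v *ℚ fromℕ (cutA 0 v u)
  P₁ v = cutB (suc c) w v *ℚ fromℕ (cutA (suc c) v u)
  neg-assoc : ∀ r a → - (i *ℚ r) *ℚ a ≡ - (i *ℚ (r *ℚ a))
  neg-assoc r a = trans (sym (ℚ.neg-distribˡ-* (i *ℚ r) a)) (cong -_ (ℚ.*-assoc i r a))
cutB-cutA {suc n} c (false ∷ w) (true ∷ u) = begin
  ∑[ v ← words (suc n) ] cutB c (false ∷ w) v *ℚ fromℕ (cutA c v (true ∷ u))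
    ≡⟨ ∑-words-suc n _ ⟩
  (∑[ v ← words n ] 0ℚ *ℚ fromℕ (suc c * cutA 0 v u)) +ℚ (∑[ v ← words n ] cutB (suc c) w v *ℚ 0ℚ)
    ≡⟨ cong₂ _+ℚ_ (∑-zero (words n) λ v → ℚ.*-zeroˡ (fromℕ (suc c * cutA 0 v u)))
                  (∑-zero (words n) λ v → ℚ.*-zeroʳ (cutB (suc c) w v)) ⟩
  0ℚ ∎
cutB-cutA {suc n} c (false ∷ w) (false ∷ u) = begin
  ∑[ v ← words (suc n) ] cutB c (false ∷ w) v *ℚ fromℕ (cutA c v (false ∷ u))
    ≡⟨ ∑-words-suc n _ ⟩
  (∑[ v ← words n ] 0ℚ *ℚ fromℕ (cutA 0 v u)) +ℚ S
    ≡⟨ cong (_+ℚ S) (∑-zero (words n) λ v → ℚ.*-zeroˡ (fromℕ (cutA 0 v u))) ⟩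
  0ℚ +ℚ S
    ≡⟨ ℚ.+-identityˡ S ⟩
  S
    ≡⟨ cutB-cutA (suc c) w u ⟩
  cutδ w u ∎
  where S = ∑[ v ← words n ] cutB (suc c) w v *ℚ fromℕ (cutA (suc c) v u)

matMul-fromCuts : ∀ n M N (M′ N′ : Vec Bool n → Vec Bool n → ℚ) →
  (∀ w v → M (fromCuts 0 w) (fromCuts 0 v) ≡ M′ w v) →
  (∀ w v → N (fromCuts 0 w) (fromCuts 0 v) ≡ N′ w v) →
  ∀ w u → matMul (suc n) M N (fromCuts 0 w) (fromCuts 0 u) ≡ ∑[ v ← words n ] M′ w v *ℚ N′ v u
matMul-fromCuts n M N M′ N′ M≡M′ N≡N′ w u = begin
  ∑ (comps (suc n)) (λ β → M (fromCuts 0 w) β *ℚ N β (fromCuts 0 u))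
    ≡⟨ cong (λ cs → ∑ cs (λ β → M (fromCuts 0 w) β *ℚ N β (fromCuts 0 u))) (comps-suc n) ⟩
  ∑ (map (fromCuts 0) (words n)) (λ β → M (fromCuts 0 w) β *ℚ N β (fromCuts 0 u))
    ≡⟨ ∑-map (fromCuts 0) (words n) _ ⟩
  ∑[ v ← words n ] M (fromCuts 0 w) (fromCuts 0 v) *ℚ N (fromCuts 0 v) (fromCuts 0 u)
    ≡⟨ ∑-cong (words n) (λ v → cong₂ _*ℚ_ (M≡M′ w v) (N≡N′ v u)) ⟩
  ∑[ v ← words n ] M′ w v *ℚ N′ v u ∎

theorem5p5 : (n : ℕ) (x y : List ℕ) → IsComp n x → IsComp n y →
    (matMul n Aentry Bentry x y ≡ δ x y) × (matMul n Bentry Aentry x y ≡ δ x y)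
theorem5p5 zero x y x∈C y∈C rewrite IsComp-zero x∈C | IsComp-zero y∈C = refl , refl
theorem5p5 (suc n) x y x∈C y∈C with fromCuts-surjective x∈C | fromCuts-surjective y∈C
... | w , refl | u , refl =
  (begin
    matMul (suc n) Aentry Bentry (fromCuts 0 w) (fromCuts 0 u)
      ≡⟨ matMul-fromCuts n Aentry Bentry A′ (cutB 0) Aentry-fromCuts Bentry-fromCuts w u ⟩
    ∑[ v ← words n ] A′ w v *ℚ cutB 0 v u
      ≡⟨ cutA-cutB 0 w u ⟩
    cutδ w u
      ≡⟨ δ-fromCuts w u ⟨
    δ (fromCuts 0 w) (fromCuts 0 u) ∎) ,
  (begin
    matMul (suc n) Bentry Aentry (fromCuts 0 w) (fromCuts 0 u)
      ≡⟨ matMul-fromCuts n Bentry Aentry (cutB 0) A′ Bentry-fromCuts Aentry-fromCuts w u ⟩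
    ∑[ v ← words n ] cutB 0 w v *ℚ A′ v u
      ≡⟨ cutB-cutA 0 w u ⟩
    cutδ w u
      ≡⟨ δ-fromCuts w u ⟨
    δ (fromCuts 0 w) (fromCuts 0 u) ∎)
  where
  A′ : Vec Bool n → Vec Bool n → ℚ
  A′ s t = fromℕ (cutA 0 s t)
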